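{- Let $G$ be a connected loopless graph (parallel edges allowed) and $k$ a positive integer with $|E(G)|=k(|V(G)|-1)$. Fix an orientation of the edges of $G$. Then the permanent modulo $k+1$ of the $k$DSI matrix of $G$ (with respect to this orientation) does not depend on the choice of special vertex; that is, for any two vertices $u,w$, the $k$DSI matrices $M_u,M_w$ with special vertices $u,w$ satisfy $\mathrm{Perm}(M_u)\equiv\mathrm{Perm}(M_w)\pmod{k+1}$.
   Context: Given a graph $G$ with a fixed orientation of its edges, its signed incidence matrix $M^*$ has rows indexed by vertices and columns by edges, with entry $1$ if the vertex is the tail of the edge, $-1$ if it is the head, and $0$ otherwise. For a chosen vertex $w$ (the special vertex), let $M$ be $M^*$ with the row of $w$ deleted. The $k$DSI matrix of $G$ with special vertex $w$ is the block matrix obtained by stacking $k$ copies of $M$ vertically. The permanent of an $n\times n$ matrix $A$ is $\mathrm{Perm}(A)=\sum_{\sigma\in S_n}\prod_i a_{i,\sigma(i)}$. -}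

module Defs where

open import Data.Nat using (ℕ; zero; suc; _*_)
open import Data.Fin using (Fin; zero; suc; punchIn; remQuot; _≟_)
open import Data.Fin.Base using ()
open import Data.Integer using (ℤ; +_; -_; _+_) renaming (_*_ to _*ℤ_)
open import Data.List using (List; []; _∷_; map; concatMap; filter; foldr; allFin)
open import Data.Product using (_×_; _,_; proj₁; proj₂)
open import Data.Vec.Functional using () renaming (_∷_ to _◂_)
open import Relation.Binary.PropositionalEquality using (_≡_)
open import Relation.Nullary using (¬_; yes; no; Dec)
open import Relation.Nullary.Decidable using (⌊_⌋)
open import Data.Bool using (Bool; true; false; _∧_; if_then_else_; not)

-- A (directed) multigraph on vertex set Fin n with m edges; edge e goes
-- from tail e to head e.  This carries the fixed orientation of the edges.
record Digraph (n m : ℕ) : Set where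
  field
    tail : Fin m → Fin n
    head : Fin m → Fin n

open Digraph public

Loopless : ∀ {n m} → Digraph n m → Set
Loopless {m = m} G = (e : Fin m) → ¬ (tail G e ≡ head G e)

data Adjacent {n m} (G : Digraph n m) : Fin n → Fin n → Set where
  fwd : (e : Fin m) → Adjacent G (tail G e) (head G e)
  bwd : (e : Fin m) → Adjacent G (head G e) (tail G e)

data Reach {n m} (G : Digraph n m) : Fin n → Fin n → Set where
  here : ∀ {v} → Reach G v v
  step : ∀ {u v w} → Adjacent G u v → Reach G v w → Reach G u w

Connected : ∀ {n m} → Digraph n m → Set
Connected {n} G = (u v : Fin n) → Reach G u v

incidence : ∀ {n m} → Digraph n m → Fin n → Fin m → ℤ
incidence G v e with v ≟ tail G e
... | yes _ = + 1
... | no _ with v ≟ head G e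
...   | yes _ = - (+ 1)
...   | no _ = + 0

-- the kDSI matrix of G (on n = suc p vertices, m = k * p edges) with
-- special vertex w: k copies of M* with row w deleted, stacked vertically.
-- Row index r : Fin (k * p) corresponds to (copy c, row i) via remQuot,
-- i.e. r = c * p + i; the rows of M are the vertices ≠ w in increasing order
-- (punchIn w i).
kDSI : ∀ k {p} → Digraph (suc p) (k * p) → Fin (suc p) →
       Fin (k * p) → Fin (k * p) → ℤ
kDSI k {p} G w r e = incidence G (punchIn w (proj₂ (remQuot {k} p r))) e

allFuns : ∀ N M → List (Fin N → Fin M)
allFuns zero M = (λ ()) ∷ []
allFuns (suc N) M = concatMap (λ f → map (λ x → x ◂ f) (allFin M)) (allFuns N M)

injective? : ∀ {N} → (Fin N → Fin N) → Bool
injective? {N} σ =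
  foldr _∧_ true (concatMap (λ i → map (λ j →
     if ⌊ σ i ≟ σ j ⌋ then ⌊ i ≟ j ⌋ else true) (allFin N)) (allFin N))

perms : ∀ N → List (Fin N → Fin N)
perms N = filter (λ σ → injective? σ Data.Bool.≟ true) (allFuns N N)

prodFin : ∀ N → (Fin N → ℤ) → ℤ
prodFin zero f = + 1
prodFin (suc N) f = f zero *ℤ prodFin N (λ i → f (suc i))

Perm : ∀ {N} → (Fin N → Fin N → ℤ) → ℤ
Perm {N} A = foldr _+_ (+ 0) (map (λ σ → prodFin N (λ i → A i (σ i))) (perms N))

module Submission where

-- Write K = k + 1.  For a multiplicity vector c on the vertices let P(c) be
-- the "multiset permanent" of the incidence matrix, in which the row of
-- vertex v is used c v times.  Three general facts about P drive the proof:
--   (1) c v ! divides P(c), as the c v copies of row v can be permuted;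
--   (2) if every column of the matrix sums to zero, then Σ_v P(c + e_v) = 0;
--   (3) Perm of a square matrix whose row i is row ℓ i of B is P(count ℓ).
-- By (3) the kDSI permanent with special vertex z is P(c) for c = K away from
-- z and c z = 0.  For distinct u, w let D a be P with a copies of u, K - a
-- copies of w and K of every other vertex.  Apply (2) with a copies of u and
-- K - 1 - a of w: the terms for v = u, w are D (a+1) and D a, every other
-- term has K + 1 copies of v and vanishes mod K + 1 by (1).  So D (a+1) ≡ - D a
-- and D K ≡ (-1)^K D 0.  For even K this is the claim; for odd K = 2m + 1,
-- K + 1 = 2(m + 1) divides 2·K!, hence 2·D 0 by (1).  Perm(M_u) = D 0 and
-- Perm(M_w) = D K give the theorem.

module Permanents where

  open import Data.Bool as Bool using (Bool; true; false; _∧_; if_then_else_)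
  open import Data.Bool.Properties using (∧-conicalˡ; ∧-conicalʳ; ⇔→≡)
  open import Data.Empty using (⊥-elim)
  open import Data.Fin using (Fin; zero; suc; _≟_; punchIn; remQuot; combine; _↑ˡ_; _↑ʳ_)
  import Data.Fin.Properties as FinP
  open import Data.Integer as ℤ using (ℤ; +_; -_; _+_; _-_; _*_; _^_; -1ℤ)
  open import Data.Integer.Divisibility.Signed
    using (∣ᵤ⇒∣; ∣-trans; ∣m∣n⇒∣m+n; ∣m⇒∣-m; ∣m∣n⇒∣m-n; ∣m+n∣n⇒∣m; ∣n⇒∣m*n; *-monoʳ-∣)
    renaming (_∣_ to _∣ₛ_)
  import Data.Integer.Properties as ℤP
  open import Data.Integer.Tactic.RingSolver using (solve-∀)
  open import Data.List using (List; []; _∷_; _++_; map; concatMap; foldr; filter; tabulate; allFin)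
  import Data.List.Properties as ListP
  open import Data.List.Relation.Unary.All using (All; []; _∷_)
  import Data.List.Relation.Unary.All.Properties as All
  open import Data.Nat as ℕ using (ℕ; zero; suc; _∸_; _!)
  import Data.Nat.Divisibility as ℕ∣
  import Data.Nat.Properties as ℕP
  open import Data.Product using (_×_; _,_; proj₁; proj₂)
  open import Data.Vec using (Vec; []; _∷_; lookup; _[_]≔_; replicate)
  open import Data.Vec.Functional using () renaming (_∷_ to _◂_)
  import Data.Vec.Properties as VecP
  open import Function using (id)
  open import Function.Bundles using (_⇔_; mk⇔; Equivalence)
  open import Function.Definitions using (Injective)
  open import Relation.Binary.PropositionalEquality
  open import Relation.Nullary using (¬_; Dec; yes; no)
  open import Relation.Nullary.Decidable using (⌊_⌋)
  open import Defs

  open import Algebra.Properties.Semiring.Sum ℤP.+-*-semiring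
    using (sum; sum-cong-≗; sum-replicate-zero; ∑-distrib-+; ∑-comm; *-distribˡ-sum; *-distribʳ-sum)

  -- Kronecker delta on Fin n, with values in ℕ (it is used both to shift
  -- multiplicities and, cast to ℤ, as a coefficient).
  δ : ∀ {n} → Fin n → Fin n → ℕ
  δ a b = if ⌊ a ≟ b ⌋ then 1 else 0

  δ-refl : ∀ {n} (a : Fin n) → δ a a ≡ 1
  δ-refl a with a ≟ a
  ... | yes _ = refl
  ... | no a≢a = ⊥-elim (a≢a refl)

  δ-≢ : ∀ {n} {a b : Fin n} → ¬ a ≡ b → δ a b ≡ 0
  δ-≢ {a = a} {b} a≢b with a ≟ b
  ... | yes a≡b = ⊥-elim (a≢b a≡b)
  ... | no _ = refl

  δ-sym : ∀ {n} (a b : Fin n) → δ a b ≡ δ b a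
  δ-sym a b with a ≟ b
  ... | yes refl = sym (δ-refl a)
  ... | no a≢b = sym (δ-≢ (≢-sym a≢b))

  δ-suc : ∀ {n} (a b : Fin n) → δ (suc a) (suc b) ≡ δ a b
  δ-suc a b with a ≟ b
  ... | yes _ = refl
  ... | no _ = refl

  sum-δ : ∀ {n} (u : Fin n) (F : Fin n → ℤ) → sum (λ v → + δ v u * F v) ≡ F u
  sum-δ {suc n} zero F = begin
      + 1 * F zero + sum (λ v → + δ (suc v) zero * F (suc v))
    ≡⟨ cong₂ _+_ (ℤP.*-identityˡ (F zero)) (sum-cong-≗ (λ v → ℤP.*-zeroˡ (F (suc v)))) ⟩
      F zero + sum {n} (λ _ → + 0)
    ≡⟨ cong (λ s → F zero + s) (sum-replicate-zero n) ⟩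
      F zero + + 0
    ≡⟨ ℤP.+-identityʳ (F zero) ⟩
      F zero ∎
    where open ≡-Reasoning
  sum-δ {suc n} (suc u) F = begin
      + 0 * F zero + sum (λ v → + δ (suc v) (suc u) * F (suc v))
    ≡⟨ ℤP.+-identityˡ _ ⟩
      sum (λ v → + δ (suc v) (suc u) * F (suc v))
    ≡⟨ sum-cong-≗ (λ v → cong (λ d → + d * F (suc v)) (δ-suc v u)) ⟩
      sum (λ v → + δ v u * F (suc v))
    ≡⟨ sum-δ u (λ v → F (suc v)) ⟩
      F (suc u) ∎
    where open ≡-Reasoning

  indicator : Bool → ℤ
  indicator true = + 1
  indicator false = + 0

  -- A multiplicity vector says how many copies of each of the R rows of a
  -- matrix are used.
  Multiplicity : ℕ → Set
  Multiplicity R = Fin R → ℕ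

  isZero : ℕ → Bool
  isZero zero = true
  isZero (suc _) = false

  allZero : ∀ {R} → Multiplicity R → Bool
  allZero {zero} c = true
  allZero {suc R} c = isZero (c zero) ∧ allZero (λ x → c (suc x))

  addRow : ∀ {R} → Multiplicity R → Fin R → Multiplicity R
  addRow c v x = δ v x ℕ.+ c x

  removeRow : ∀ {R} → Multiplicity R → Fin R → Multiplicity R
  removeRow c v x = c x ∸ δ v x

  -- The multiset permanent: the sum, over all injective placements of the
  -- row copies (c v labelled copies of row v of B) into the columns marked
  -- true in S, of the product of the entries hit.  For a square matrix with all columns available
  -- this is the permanent of the matrix with row v repeated c v times.
  mperm : ∀ {R M} → Multiplicity R → Vec Bool M → (Fin R → Fin M → ℤ) → ℤ
  mperm c [] B = indicator (allZero c)
  mperm c (false ∷ S) B = mperm c S (λ v j → B v (suc j))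
  mperm c (true ∷ S) B = mperm c S (λ v j → B v (suc j))
    + sum (λ v → B v zero * (+ c v * mperm (removeRow c v) S (λ v j → B v (suc j))))

  allZero-cong : ∀ {R} {c c' : Multiplicity R} → (∀ x → c x ≡ c' x) → allZero c ≡ allZero c'
  allZero-cong {zero} c≗c' = refl
  allZero-cong {suc R} c≗c' =
    cong₂ (λ a b → isZero a ∧ b) (c≗c' zero) (allZero-cong (λ x → c≗c' (suc x)))

  allZero-suc : ∀ {R} (c : Multiplicity R) (x : Fin R) {m} → c x ≡ suc m → allZero c ≡ false
  allZero-suc {suc R} c zero cx≡1+m rewrite cx≡1+m = refl
  allZero-suc {suc R} c (suc x) cx≡1+m with isZero (c zero)
  ... | true = allZero-suc (λ y → c (suc y)) x cx≡1+m
  ... | false = refl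

  allZero-addRow : ∀ {R} (c : Multiplicity R) v → allZero (addRow c v) ≡ false
  allZero-addRow c v = allZero-suc (addRow c v) v (cong (ℕ._+ c v) (δ-refl v))

  mperm-cong : ∀ {R M} (S : Vec Bool M) (B : Fin R → Fin M → ℤ) {c c' : Multiplicity R} →
               (∀ x → c x ≡ c' x) → mperm c S B ≡ mperm c' S B
  mperm-cong [] B c≗c' = cong indicator (allZero-cong c≗c')
  mperm-cong (false ∷ S) B c≗c' = mperm-cong S _ c≗c'
  mperm-cong (true ∷ S) B c≗c' = cong₂ _+_ (mperm-cong S _ c≗c') (sum-cong-≗ (λ v →
    cong₂ (λ a b → B v zero * (+ a * b)) (c≗c' v)
          (mperm-cong S _ (λ x → cong (_∸ δ v x) (c≗c' x)))))

  ∣-zero : ∀ d → d ∣ₛ + 0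
  ∣-zero d = ∣ᵤ⇒∣ (ℕ∣._∣0 ℤ.∣ d ∣)

  one-∣ : ∀ x → + 1 ∣ₛ x
  one-∣ x = ∣ᵤ⇒∣ (ℕ∣.1∣ ℤ.∣ x ∣)

  ∣-sum : ∀ {n} {d : ℤ} (f : Fin n → ℤ) → (∀ i → d ∣ₛ f i) → d ∣ₛ sum f
  ∣-sum {zero} {d} f d∣f = ∣-zero d
  ∣-sum {suc n} f d∣f = ∣m∣n⇒∣m+n (d∣f zero) (∣-sum (λ i → f (suc i)) (λ i → d∣f (suc i)))

  removeRow-≢ : ∀ {R} (c : Multiplicity R) {u v} → ¬ u ≡ v → removeRow c u v ≡ c v
  removeRow-≢ c u≢v = cong (c _ ∸_) (δ-≢ u≢v)

  removeRow-same : ∀ {R} (c : Multiplicity R) v {m} → c v ≡ suc m → removeRow c v v ≡ m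
  removeRow-same c v cv≡1+m = trans (cong (c v ∸_) (δ-refl v)) (cong (_∸ 1) cv≡1+m)

  -- c v ! divides the multiset permanent: the c v copies of row v can be
  -- permuted among themselves.  Inductively, a placement using one copy of row
  -- v in the first column comes with the factor c v, and the rest with (c v - 1)!.
  factorial-∣-mperm : ∀ {R M} (S : Vec Bool M) (B : Fin R → Fin M → ℤ) (c : Multiplicity R) v →
                      + (c v !) ∣ₛ mperm c S B
  factorial-∣-mperm [] B c v with c v in cv≡
  ... | zero = one-∣ _
  ... | suc m rewrite allZero-suc c v cv≡ = ∣-zero _
  factorial-∣-mperm (false ∷ S) B c v = factorial-∣-mperm S _ c v
  factorial-∣-mperm (true ∷ S) B c v =
    ∣m∣n⇒∣m+n (factorial-∣-mperm S B⁺ c v) (∣-sum _ placeRow)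
    where
    B⁺ = λ x j → B x (suc j)
    placeRow : ∀ u → + (c v !) ∣ₛ B u zero * (+ c u * mperm (removeRow c u) S B⁺)
    placeRow u with u ≟ v
    ... | no u≢v = ∣n⇒∣m*n (B u zero) (∣n⇒∣m*n (+ c u)
          (subst (λ a → + (a !) ∣ₛ mperm (removeRow c u) S B⁺) (removeRow-≢ c u≢v)
                 (factorial-∣-mperm S B⁺ (removeRow c u) v)))
    ... | yes refl with c u in cu≡
    ...   | zero = one-∣ _
    ...   | suc m = ∣n⇒∣m*n (B u zero)
            (subst (_∣ₛ + suc m * mperm (removeRow c u) S B⁺) (sym (ℤP.pos-* (suc m) (m !)))
              (*-monoʳ-∣ (+ suc m)
                (subst (λ a → + (a !) ∣ₛ mperm (removeRow c u) S B⁺) (removeRow-same c u cu≡)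
                       (factorial-∣-mperm S B⁺ (removeRow c u) u))))

  ZeroColumnSums : ∀ {R M} → (Fin R → Fin M → ℤ) → Set
  ZeroColumnSums B = ∀ j → sum (λ v → B v j) ≡ + 0

  δ≤ : ∀ {R} (c : Multiplicity R) (u x : Fin R) {m} → c u ≡ suc m → δ u x ℕ.≤ c x
  δ≤ c u x cu≡1+m with u ≟ x
  ... | yes refl rewrite cu≡1+m = ℕ.s≤s ℕ.z≤n
  ... | no _ = ℕ.z≤n

  -- The copy of row u put into a column is either the added one (v = u),
  -- leaving mperm c, or one of the c u original copies; the latter terms add
  -- up to c u · Σ_v mperm (c - e_u + e_v), which vanishes by hypothesis.
  sum-addRow-removeRow : ∀ {R M} (S : Vec Bool M) (B : Fin R → Fin M → ℤ) →
    (∀ c → sum (λ v → mperm (addRow c v) S B) ≡ + 0) →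
    ∀ c u → sum (λ v → + addRow c v u * mperm (removeRow (addRow c v) u) S B) ≡ mperm c S B
  sum-addRow-removeRow {R} S B addRow-sum c u = begin
      sum (λ v → + addRow c v u * G v)
    ≡⟨ sum-cong-≗ (λ v → trans (cong (_* G v) (ℤP.pos-+ (δ v u) (c u)))
                                (ℤP.*-distribʳ-+ (G v) (+ δ v u) (+ c u))) ⟩
      sum (λ v → + δ v u * G v + + c u * G v)
    ≡⟨ ∑-distrib-+ (λ v → + δ v u * G v) (λ v → + c u * G v) ⟩
      sum (λ v → + δ v u * G v) + sum (λ v → + c u * G v)
    ≡⟨ cong₂ _+_ (sum-δ u G) (sym (*-distribˡ-sum (+ c u) G)) ⟩
      G u + + c u * sum G
    ≡⟨ cong₂ _+_ (mperm-cong S B (λ x → ℕP.m+n∸m≡n (δ u x) (c x))) copiesOfU ⟩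
      mperm c S B + + 0
    ≡⟨ ℤP.+-identityʳ _ ⟩
      mperm c S B ∎
    where
    open ≡-Reasoning
    G : Fin R → ℤ
    G v = mperm (removeRow (addRow c v) u) S B
    copiesOfU : + c u * sum G ≡ + 0
    copiesOfU with c u in cu≡
    ... | zero = ℤP.*-zeroˡ (sum G)
    ... | suc m = trans (cong (+ suc m *_) (trans
            (sum-cong-≗ (λ v → mperm-cong S B (λ x → ℕP.+-∸-assoc (δ v x) (δ≤ c u x cu≡))))
            (addRow-sum (removeRow c u))))
          (ℤP.*-zeroʳ (+ suc m))

  -- Fact (2): if the columns of B sum to zero, then Σ_v mperm (c + e_v) = 0.
  -- (Adding a copy of row v, summed over v, adds the zero row Σ_v B v.)
  mperm-addRow-sum : ∀ {R M} (S : Vec Bool M) (B : Fin R → Fin M → ℤ) → ZeroColumnSums B →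
                     ∀ c → sum (λ v → mperm (addRow c v) S B) ≡ + 0
  mperm-addRow-sum {R} [] B colSums c =
    trans (sum-cong-≗ (λ v → cong indicator (allZero-addRow c v))) (sum-replicate-zero R)
  mperm-addRow-sum (false ∷ S) B colSums c = mperm-addRow-sum S _ (λ j → colSums (suc j)) c
  mperm-addRow-sum {R} (true ∷ S) B colSums c = begin
      sum (λ v → mperm (addRow c v) S B⁺ + sum (λ u → B u zero * placed v u))
    ≡⟨ ∑-distrib-+ (λ v → mperm (addRow c v) S B⁺) (λ v → sum (λ u → B u zero * placed v u)) ⟩
      sum (λ v → mperm (addRow c v) S B⁺) + sum (λ v → sum (λ u → B u zero * placed v u))
    ≡⟨ cong₂ _+_ (IH c) (∑-comm (λ v u → B u zero * placed v u)) ⟩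
      + 0 + sum (λ u → sum (λ v → B u zero * placed v u))
    ≡⟨ ℤP.+-identityˡ _ ⟩
      sum (λ u → sum (λ v → B u zero * placed v u))
    ≡⟨ sum-cong-≗ (λ u → trans (sym (*-distribˡ-sum (B u zero) (λ v → placed v u)))
                                (cong (B u zero *_) (sum-addRow-removeRow S B⁺ IH c u))) ⟩
      sum (λ u → B u zero * mperm c S B⁺)
    ≡⟨ sym (*-distribʳ-sum (mperm c S B⁺) (λ u → B u zero)) ⟩
      sum (λ u → B u zero) * mperm c S B⁺
    ≡⟨ cong (_* mperm c S B⁺) (colSums zero) ⟩
      + 0 * mperm c S B⁺
    ≡⟨ ℤP.*-zeroˡ (mperm c S B⁺) ⟩
      + 0 ∎
    where
    open ≡-Reasoning
    B⁺ = λ x j → B x (suc j)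
    IH = mperm-addRow-sum S B⁺ (λ j → colSums (suc j))
    placed : Fin R → Fin R → ℤ
    placed v u = + addRow c v u * mperm (removeRow (addRow c v) u) S B⁺

  -- injPerm W S: the sum, over injective maps f from the rows of W into the
  -- columns marked true in S, of Π_i W i (f i); expanded along the first row.
  injPerm : ∀ {N M} → (Fin N → Fin M → ℤ) → Vec Bool M → ℤ
  injPerm {zero} W S = + 1
  injPerm {suc N} W S =
    sum (λ x → indicator (lookup S x) * (W zero x * injPerm (λ i → W (suc i)) (S [ x ]≔ false)))

  injPerm-unavailable : ∀ {N M} (W : Fin N → Fin (suc M) → ℤ) S →
                        injPerm W (false ∷ S) ≡ injPerm (λ i j → W i (suc j)) S
  injPerm-unavailable {zero} W S = refl
  injPerm-unavailable {suc N} W S = begin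
      + 0 * (W zero zero * injPerm W' (false ∷ S)) + sum (λ x → place x (injPerm W' (false ∷ S' x)))
    ≡⟨ cong (_+ sum (λ x → place x (injPerm W' (false ∷ S' x))))
            (ℤP.*-zeroˡ (W zero zero * injPerm W' (false ∷ S))) ⟩
      + 0 + sum (λ x → place x (injPerm W' (false ∷ S' x)))
    ≡⟨ ℤP.+-identityˡ _ ⟩
      sum (λ x → place x (injPerm W' (false ∷ S' x)))
    ≡⟨ sum-cong-≗ (λ x → cong (place x) (injPerm-unavailable W' (S' x))) ⟩
      sum (λ x → place x (injPerm (λ i j → W' i (suc j)) (S' x))) ∎
    where
    open ≡-Reasoning
    W' = λ i → W (suc i)
    S' = λ x → S [ x ]≔ false
    place = λ x p → indicator (lookup S x) * (W zero (suc x) * p)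

  injPerm-column-expansion : ∀ {N M} (W : Fin (suc N) → Fin (suc M) → ℤ) S →
    injPerm W (true ∷ S) ≡
      injPerm (λ i j → W i (suc j)) S + sum (λ i → W i zero * injPerm (λ r j → W (punchIn i r) (suc j)) S)
  injPerm-column-expansion {zero} W S = oneRow (W zero zero) (injPerm (λ i j → W i (suc j)) S)
    where
    oneRow : ∀ w X → + 1 * (w * + 1) + X ≡ X + (w * + 1 + + 0)
    oneRow = solve-∀
  injPerm-column-expansion {suc N} {M} W S = begin
      + 1 * (W zero zero * injPerm W' (false ∷ S)) + sum (λ x → place x (injPerm W' (true ∷ S' x)))
    ≡⟨ cong₂ _+_ (cong (λ p → + 1 * (W zero zero * p)) (injPerm-unavailable W' S))
                 (sum-cong-≗ (λ x → cong (place x) (injPerm-column-expansion W' (S' x)))) ⟩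
      + 1 * (W zero zero * P0) + sum (λ x → place x (P x + sum (λ i → Wi i * Q i x)))
    ≡⟨ cong (λ z → + 1 * (W zero zero * P0) + z) regroup ⟩
      + 1 * (W zero zero * P0) + (sum (λ x → place x (P x)) + sum (λ i → Wi i * sum (λ x → place x (Q i x))))
    ≡⟨ reorder (W zero zero * P0) (sum (λ x → place x (P x))) (sum (λ i → Wi i * sum (λ x → place x (Q i x)))) ⟩
      sum (λ x → place x (P x)) + (W zero zero * P0 + sum (λ i → Wi i * sum (λ x → place x (Q i x)))) ∎
    where
    open ≡-Reasoning
    W' = λ i → W (suc i)
    S' = λ x → S [ x ]≔ false
    place : Fin M → ℤ → ℤ
    place x p = indicator (lookup S x) * (W zero (suc x) * p)
    P0 = injPerm (λ i j → W (suc i) (suc j)) S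
    P = λ x → injPerm (λ i j → W (suc i) (suc j)) (S' x)
    Wi = λ (i : Fin (suc N)) → W (suc i) zero
    Q = λ (i : Fin (suc N)) x → injPerm (λ r j → W (suc (punchIn i r)) (suc j)) (S' x)
    place-distrib : ∀ x p q → place x (p + q) ≡ place x p + place x q
    place-distrib x p q = distrib (indicator (lookup S x)) (W zero (suc x)) p q
      where
      distrib : ∀ s w p q → s * (w * (p + q)) ≡ s * (w * p) + s * (w * q)
      distrib = solve-∀
    place-scale : ∀ x y q → place x (y * q) ≡ y * place x q
    place-scale x y q = scale (indicator (lookup S x)) (W zero (suc x)) y q
      where
      scale : ∀ s w y q → s * (w * (y * q)) ≡ y * (s * (w * q))
      scale = solve-∀
    place-sum : ∀ x (f : Fin (suc N) → ℤ) → place x (sum f) ≡ sum (λ i → place x (f i))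
    place-sum x f = trans (cong (indicator (lookup S x) *_) (*-distribˡ-sum (W zero (suc x)) f))
                          (*-distribˡ-sum (indicator (lookup S x)) (λ i → W zero (suc x) * f i))
    regroup : sum (λ x → place x (P x + sum (λ i → Wi i * Q i x))) ≡
              sum (λ x → place x (P x)) + sum (λ i → Wi i * sum (λ x → place x (Q i x)))
    regroup = begin
        sum (λ x → place x (P x + sum (λ i → Wi i * Q i x)))
      ≡⟨ sum-cong-≗ (λ x → trans (place-distrib x (P x) _)
                                  (cong (λ z → place x (P x) + z) (place-sum x (λ i → Wi i * Q i x)))) ⟩
        sum (λ x → place x (P x) + sum (λ i → place x (Wi i * Q i x)))
      ≡⟨ ∑-distrib-+ (λ x → place x (P x)) (λ x → sum (λ i → place x (Wi i * Q i x))) ⟩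
        sum (λ x → place x (P x)) + sum (λ x → sum (λ i → place x (Wi i * Q i x)))
      ≡⟨ cong (λ z → sum (λ x → place x (P x)) + z) (∑-comm (λ x i → place x (Wi i * Q i x))) ⟩
        sum (λ x → place x (P x)) + sum (λ i → sum (λ x → place x (Wi i * Q i x)))
      ≡⟨ cong (λ z → sum (λ x → place x (P x)) + z) (sum-cong-≗ (λ i → trans
            (sum-cong-≗ (λ x → place-scale x (Wi i) (Q i x)))
            (sym (*-distribˡ-sum (Wi i) (λ x → place x (Q i x)))))) ⟩
        sum (λ x → place x (P x)) + sum (λ i → Wi i * sum (λ x → place x (Q i x))) ∎
    reorder : ∀ y X Z → + 1 * y + (X + Z) ≡ X + (y + Z)
    reorder = solve-∀

  -- count ℓ v: the number of i with ℓ i = v.  A matrix whose row i is row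
  -- ℓ i of B is B with row v taken count ℓ v times.
  count : ∀ {N R} → (Fin N → Fin R) → Multiplicity R
  count {zero} ℓ v = 0
  count {suc N} ℓ v = δ (ℓ zero) v ℕ.+ count (λ i → ℓ (suc i)) v

  δ≤count : ∀ {N R} (ℓ : Fin N → Fin R) i v → δ (ℓ i) v ℕ.≤ count ℓ v
  δ≤count ℓ zero v = ℕP.m≤m+n _ _
  δ≤count ℓ (suc i) v = ℕP.≤-trans (δ≤count (λ i → ℓ (suc i)) i v) (ℕP.m≤n+m _ _)

  count-punchIn : ∀ {N R} (ℓ : Fin (suc N) → Fin R) i v →
                  count (λ r → ℓ (punchIn i r)) v ≡ removeRow (count ℓ) (ℓ i) v
  count-punchIn ℓ zero v = sym (ℕP.m+n∸m≡n (δ (ℓ zero) v) _)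
  count-punchIn {suc N} ℓ (suc i) v =
    trans (cong (δ (ℓ zero) v ℕ.+_) (count-punchIn (λ r → ℓ (suc r)) i v))
          (sym (ℕP.+-∸-assoc (δ (ℓ zero) v) (δ≤count (λ r → ℓ (suc r)) i v)))

  allZero-count : ∀ {N R} (ℓ : Fin N → Fin R) → allZero (count ℓ) ≡ isZero N
  allZero-count {zero} {zero} ℓ = refl
  allZero-count {zero} {suc R} ℓ = allZero-count {zero} {R} (λ ())
  allZero-count {suc N} ℓ =
    allZero-suc (count ℓ) (ℓ zero) (cong (ℕ._+ count (λ i → ℓ (suc i)) (ℓ zero)) (δ-refl (ℓ zero)))

  sum-by-count : ∀ {N R} (ℓ : Fin N → Fin R) (h : Fin R → ℤ) →
                 sum (λ i → h (ℓ i)) ≡ sum (λ v → + count ℓ v * h v)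
  sum-by-count {zero} {R} ℓ h =
    sym (trans (sum-cong-≗ (λ v → ℤP.*-zeroˡ (h v))) (sum-replicate-zero R))
  sum-by-count {suc N} ℓ h = begin
      h (ℓ zero) + sum (λ i → h (ℓ (suc i)))
    ≡⟨ cong₂ _+_ (sym (sum-δ (ℓ zero) h)) (sum-by-count ℓ' h) ⟩
      sum (λ v → + δ v (ℓ zero) * h v) + sum (λ v → + count ℓ' v * h v)
    ≡⟨ sym (∑-distrib-+ (λ v → + δ v (ℓ zero) * h v) (λ v → + count ℓ' v * h v)) ⟩
      sum (λ v → + δ v (ℓ zero) * h v + + count ℓ' v * h v)
    ≡⟨ sum-cong-≗ (λ v → trans (sym (ℤP.*-distribʳ-+ (h v) (+ δ v (ℓ zero)) (+ count ℓ' v)))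
                                (cong (λ d → + (d ℕ.+ count ℓ' v) * h v) (δ-sym v (ℓ zero)))) ⟩
      sum (λ v → + count ℓ v * h v) ∎
    where
    open ≡-Reasoning
    ℓ' = λ i → ℓ (suc i)

  injPerm≡mperm : ∀ {M} (S : Vec Bool M) {N R} (ℓ : Fin N → Fin R) (B : Fin R → Fin M → ℤ) →
                  injPerm (λ i → B (ℓ i)) S ≡ mperm (count ℓ) S B
  injPerm≡mperm [] {zero} ℓ B = cong indicator (sym (allZero-count ℓ))
  injPerm≡mperm [] {suc N} ℓ B = cong indicator (sym (allZero-count ℓ))
  injPerm≡mperm (false ∷ S) ℓ B =
    trans (injPerm-unavailable (λ i → B (ℓ i)) S) (injPerm≡mperm S ℓ (λ v j → B v (suc j)))
  injPerm≡mperm (true ∷ S) {zero} {R} ℓ B = begin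
      injPerm {zero} (λ i → B⁺ (ℓ i)) S
    ≡⟨ injPerm≡mperm S ℓ B⁺ ⟩
      mperm (count ℓ) S B⁺
    ≡⟨ sym (ℤP.+-identityʳ _) ⟩
      mperm (count ℓ) S B⁺ + + 0
    ≡⟨ cong (λ z → mperm (count ℓ) S B⁺ + z) (sym (trans (sum-cong-≗ noCopies) (sum-replicate-zero R))) ⟩
      mperm (count ℓ) (true ∷ S) B ∎
    where
    open ≡-Reasoning
    B⁺ = λ v j → B v (suc j)
    noCopies : ∀ v → B v zero * (+ 0 * mperm (removeRow (count ℓ) v) S B⁺) ≡ + 0
    noCopies v = trans (cong (B v zero *_) (ℤP.*-zeroˡ (mperm (removeRow (count ℓ) v) S B⁺))) (ℤP.*-zeroʳ (B v zero))
  injPerm≡mperm (true ∷ S) {suc N} ℓ B = begin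
      injPerm (λ i → B (ℓ i)) (true ∷ S)
    ≡⟨ injPerm-column-expansion (λ i → B (ℓ i)) S ⟩
      injPerm (λ i → B⁺ (ℓ i)) S + sum (λ i → B (ℓ i) zero * injPerm (λ r → B⁺ (ℓ (punchIn i r))) S)
    ≡⟨ cong₂ _+_ (injPerm≡mperm S ℓ B⁺) (sum-cong-≗ (λ i → cong (B (ℓ i) zero *_)
         (trans (injPerm≡mperm S (λ r → ℓ (punchIn i r)) B⁺) (mperm-cong S B⁺ (count-punchIn ℓ i))))) ⟩
      mperm (count ℓ) S B⁺ + sum (λ i → h (ℓ i))
    ≡⟨ cong (λ z → mperm (count ℓ) S B⁺ + z) (sum-by-count ℓ h) ⟩
      mperm (count ℓ) S B⁺ + sum (λ v → + count ℓ v * h v)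
    ≡⟨ cong (λ z → mperm (count ℓ) S B⁺ + z) (sum-cong-≗ (λ v → swap (+ count ℓ v) (B v zero) _)) ⟩
      mperm (count ℓ) (true ∷ S) B ∎
    where
    open ≡-Reasoning
    B⁺ = λ v j → B v (suc j)
    h = λ v → B v zero * mperm (removeRow (count ℓ) v) S B⁺
    swap : ∀ a b c → a * (b * c) ≡ b * (a * c)
    swap = solve-∀

  listSum : List ℤ → ℤ
  listSum = foldr _+_ (+ 0)

  listSum-++ : ∀ xs ys → listSum (xs ++ ys) ≡ listSum xs + listSum ys
  listSum-++ [] ys = sym (ℤP.+-identityˡ _)
  listSum-++ (x ∷ xs) ys =
    trans (cong (λ s → x + s) (listSum-++ xs ys)) (sym (ℤP.+-assoc x (listSum xs) (listSum ys)))

  listSum-concatMap : ∀ {A B : Set} (g : B → ℤ) (h : A → List B) xs →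
    listSum (map g (concatMap h xs)) ≡ listSum (map (λ a → listSum (map g (h a))) xs)
  listSum-concatMap g h [] = refl
  listSum-concatMap g h (a ∷ as) = begin
      listSum (map g (h a ++ concatMap h as))
    ≡⟨ cong listSum (ListP.map-++ g (h a) (concatMap h as)) ⟩
      listSum (map g (h a) ++ map g (concatMap h as))
    ≡⟨ listSum-++ (map g (h a)) _ ⟩
      listSum (map g (h a)) + listSum (map g (concatMap h as))
    ≡⟨ cong (λ s → listSum (map g (h a)) + s) (listSum-concatMap g h as) ⟩
      listSum (map (λ a → listSum (map g (h a))) (a ∷ as)) ∎
    where open ≡-Reasoning

  listSum-tabulate : ∀ {n} (g : Fin n → ℤ) → listSum (tabulate g) ≡ sum g
  listSum-tabulate {zero} g = refl
  listSum-tabulate {suc n} g = cong (λ s → g zero + s) (listSum-tabulate (λ x → g (suc x)))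

  listSum-sum : ∀ {A : Set} {n} (H : A → Fin n → ℤ) xs →
    listSum (map (λ a → sum (H a)) xs) ≡ sum (λ x → listSum (map (λ a → H a x) xs))
  listSum-sum {n = n} H [] = sym (sum-replicate-zero n)
  listSum-sum H (a ∷ as) = trans (cong (λ s → sum (H a) + s) (listSum-sum H as))
                                 (sym (∑-distrib-+ (H a) (λ x → listSum (map (λ b → H b x) as))))

  listSum-scale : ∀ {A : Set} (c : ℤ) (K : A → ℤ) xs →
                  listSum (map (λ a → c * K a) xs) ≡ c * listSum (map K xs)
  listSum-scale c K [] = sym (ℤP.*-zeroʳ c)
  listSum-scale c K (a ∷ as) =
    trans (cong (λ s → c * K a + s) (listSum-scale c K as)) (sym (ℤP.*-distribˡ-+ c (K a) _))

  listSum-allFuns : ∀ {N M} (g : (Fin (suc N) → Fin M) → ℤ) →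
    listSum (map g (allFuns (suc N) M)) ≡ sum (λ x → listSum (map (λ f → g (x ◂ f)) (allFuns N M)))
  listSum-allFuns {N} {M} g = begin
      listSum (map g (allFuns (suc N) M))
    ≡⟨ listSum-concatMap g (λ f → map (_◂ f) (allFin M)) (allFuns N M) ⟩
      listSum (map (λ f → listSum (map g (map (_◂ f) (allFin M)))) (allFuns N M))
    ≡⟨ cong listSum (ListP.map-cong (λ f → trans (cong listSum (trans (sym (ListP.map-∘ (allFin M)))
                                                                     (ListP.map-tabulate id (λ x → g (x ◂ f)))))
                                                 (listSum-tabulate (λ x → g (x ◂ f)))) (allFuns N M)) ⟩
      listSum (map (λ f → sum (λ x → g (x ◂ f))) (allFuns N M))
    ≡⟨ listSum-sum (λ f x → g (x ◂ f)) (allFuns N M) ⟩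
      sum (λ x → listSum (map (λ f → g (x ◂ f)) (allFuns N M))) ∎
    where open ≡-Reasoning

  -- fits f S: f is injective and takes values only in columns marked true in
  -- S, decided by placing the values f 0, f 1, ... one after another.
  fits : ∀ {N M} → (Fin N → Fin M) → Vec Bool M → Bool
  fits {zero} f S = true
  fits {suc N} f S = lookup S (f zero) ∧ fits (λ i → f (suc i)) (S [ f zero ]≔ false)

  indicator-∧ : ∀ a b → indicator (a ∧ b) ≡ indicator a * indicator b
  indicator-∧ true true = refl
  indicator-∧ true false = refl
  indicator-∧ false b = refl

  listSum-fits : ∀ {N M} (W : Fin N → Fin M → ℤ) S →
    listSum (map (λ f → indicator (fits f S) * prodFin N (λ i → W i (f i))) (allFuns N M)) ≡ injPerm W S
  listSum-fits {zero} W S = refl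
  listSum-fits {suc N} {M} W S = begin
      listSum (map term (allFuns (suc N) M))
    ≡⟨ listSum-allFuns term ⟩
      sum (λ x → listSum (map (λ f → term (x ◂ f)) (allFuns N M)))
    ≡⟨ sum-cong-≗ (λ x → cong listSum (ListP.map-cong (split x) (allFuns N M))) ⟩
      sum (λ x → listSum (map (λ f → a x * rest x f) (allFuns N M)))
    ≡⟨ sum-cong-≗ (λ x → trans (listSum-scale (a x) (rest x) (allFuns N M))
                                (cong (a x *_) (listSum-fits (λ i → W (suc i)) (S [ x ]≔ false)))) ⟩
      sum (λ x → a x * injPerm (λ i → W (suc i)) (S [ x ]≔ false))
    ≡⟨ sum-cong-≗ (λ x → ℤP.*-assoc (indicator (lookup S x)) (W zero x) _) ⟩
      injPerm W S ∎
    where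
    open ≡-Reasoning
    term = λ f → indicator (fits f S) * prodFin (suc N) (λ i → W i (f i))
    a = λ x → indicator (lookup S x) * W zero x
    rest = λ x f → indicator (fits f (S [ x ]≔ false)) * prodFin N (λ i → W (suc i) (f i))
    split : ∀ x f → term (x ◂ f) ≡ a x * rest x f
    split x f = trans (cong (_* (W zero x * prodFin N (λ i → W (suc i) (f i))))
                            (indicator-∧ (lookup S x) (fits f (S [ x ]≔ false))))
                      (shuffle (indicator (lookup S x)) (indicator (fits f (S [ x ]≔ false)))
                               (W zero x) (prodFin N (λ i → W (suc i) (f i))))
      where
      shuffle : ∀ p q r s → p * q * (r * s) ≡ p * r * (q * s)
      shuffle = solve-∀

  fits-sound : ∀ {N M} (f : Fin N → Fin M) S → fits f S ≡ true →
               Injective _≡_ _≡_ f × (∀ i → lookup S (f i) ≡ true)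
  fits-sound {zero} f S _ = (λ {}) , (λ ())
  fits-sound {suc N} f S fits≡ = injective , available
    where
    S' = S [ f zero ]≔ false
    rest = fits-sound (λ i → f (suc i)) S' (∧-conicalʳ _ _ fits≡)
    -- f 0 is no longer available to the other rows
    f-suc≢f-zero : ∀ i → ¬ f (suc i) ≡ f zero
    f-suc≢f-zero i eq with () ← trans (sym (VecP.lookup∘update (f zero) S false))
                                        (trans (cong (lookup S') (sym eq)) (proj₂ rest i))
    available : ∀ i → lookup S (f i) ≡ true
    available zero = ∧-conicalˡ _ _ fits≡
    available (suc i) = trans (sym (VecP.lookup∘update′ (f-suc≢f-zero i) S false)) (proj₂ rest i)
    injective : Injective _≡_ _≡_ f
    injective {zero} {zero} _ = refl
    injective {zero} {suc j} eq = ⊥-elim (f-suc≢f-zero j (sym eq))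
    injective {suc i} {zero} eq = ⊥-elim (f-suc≢f-zero i eq)
    injective {suc i} {suc j} eq = cong suc (proj₁ rest eq)

  fits-complete : ∀ {N M} (f : Fin N → Fin M) S → Injective _≡_ _≡_ f →
                  (∀ i → lookup S (f i) ≡ true) → fits f S ≡ true
  fits-complete {zero} f S _ _ = refl
  fits-complete {suc N} f S injective available =
    cong₂ _∧_ (available zero)
      (fits-complete (λ i → f (suc i)) (S [ f zero ]≔ false) (λ eq → FinP.suc-injective (injective eq))
        (λ i → trans (VecP.lookup∘update′ (λ eq → FinP.0≢1+n (sym (injective eq))) S false) (available (suc i))))

  and-true⁻ : ∀ xs → foldr _∧_ true xs ≡ true → All (_≡ true) xs
  and-true⁻ [] _ = []
  and-true⁻ (x ∷ xs) and≡ = ∧-conicalˡ x _ and≡ ∷ and-true⁻ xs (∧-conicalʳ x _ and≡)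

  and-true⁺ : ∀ {xs} → All (_≡ true) xs → foldr _∧_ true xs ≡ true
  and-true⁺ [] = refl
  and-true⁺ (refl ∷ all) = and-true⁺ all

  injective?-correct : ∀ {N} (σ : Fin N → Fin N) → (injective? σ ≡ true) ⇔ Injective _≡_ _≡_ σ
  injective?-correct {N} σ = mk⇔
    (λ inj?≡ {i} {j} → pairTest-sound i j
       (All.tabulate⁻ (All.map⁻ (All.tabulate⁻ (All.map⁻ (All.concat⁻ (and-true⁻ _ inj?≡))) i)) j))
    (λ injective → and-true⁺ (All.concat⁺ (All.map⁺ (All.tabulate⁺ (λ i →
       All.map⁺ (All.tabulate⁺ (λ j → pairTest-complete i j injective)))))))
    where
    pairTest : Fin N → Fin N → Bool
    pairTest i j = if ⌊ σ i ≟ σ j ⌋ then ⌊ i ≟ j ⌋ else true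
    pairTest-sound : ∀ i j → pairTest i j ≡ true → σ i ≡ σ j → i ≡ j
    pairTest-sound i j test≡ σi≡σj with σ i ≟ σ j | i ≟ j
    ... | _ | yes i≡j = i≡j
    ... | yes _ | no _ with () ← test≡
    ... | no σi≢σj | no _ = ⊥-elim (σi≢σj σi≡σj)
    pairTest-complete : ∀ i j → Injective _≡_ _≡_ σ → pairTest i j ≡ true
    pairTest-complete i j injective with σ i ≟ σ j
    ... | no _ = refl
    ... | yes σi≡σj with i ≟ j
    ...   | yes _ = refl
    ...   | no i≢j = ⊥-elim (i≢j (injective σi≡σj))

  injective?≡fits : ∀ {N} (σ : Fin N → Fin N) → injective? σ ≡ fits σ (replicate N true)
  injective?≡fits {N} σ = ⇔→≡ (mk⇔
    (λ inj?≡ → fits-complete σ _ (Equivalence.to (injective?-correct σ) inj?≡)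
                                 (λ i → VecP.lookup-replicate (σ i) true))
    (λ fits≡ → Equivalence.from (injective?-correct σ) (proj₁ (fits-sound σ _ fits≡))))

  listSum-perms : ∀ {N} (g : (Fin N → Fin N) → ℤ) fs →
    listSum (map g (filter (λ σ → injective? σ Bool.≟ true) fs)) ≡
    listSum (map (λ σ → indicator (injective? σ) * g σ) fs)
  listSum-perms g [] = refl
  listSum-perms g (σ ∷ fs) with injective? σ
  ... | true = cong₂ _+_ (sym (ℤP.*-identityˡ (g σ))) (listSum-perms g fs)
  ... | false = trans (listSum-perms g fs) (sym (trans (cong (_+ rest) (ℤP.*-zeroˡ (g σ))) (ℤP.+-identityˡ rest)))
    where rest = listSum (map (λ σ → indicator (injective? σ) * g σ) fs)

  Perm≡injPerm : ∀ {N} (A : Fin N → Fin N → ℤ) → Perm A ≡ injPerm A (replicate N true)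
  Perm≡injPerm {N} A = begin
      Perm A
    ≡⟨ listSum-perms (λ σ → prodFin N (λ i → A i (σ i))) (allFuns N N) ⟩
      listSum (map (λ σ → indicator (injective? σ) * prodFin N (λ i → A i (σ i))) (allFuns N N))
    ≡⟨ cong listSum (ListP.map-cong (λ σ → cong (λ b → indicator b * prodFin N (λ i → A i (σ i)))
                                                  (injective?≡fits σ)) (allFuns N N)) ⟩
      listSum (map (λ σ → indicator (fits σ (replicate N true)) * prodFin N (λ i → A i (σ i))) (allFuns N N))
    ≡⟨ listSum-fits A (replicate N true) ⟩
      injPerm A (replicate N true) ∎
    where open ≡-Reasoning

  count-cong : ∀ {N R} {ℓ ℓ' : Fin N → Fin R} → (∀ i → ℓ i ≡ ℓ' i) → ∀ x → count ℓ x ≡ count ℓ' x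
  count-cong {zero} ℓ≗ℓ' x = refl
  count-cong {suc N} ℓ≗ℓ' x = cong₂ ℕ._+_ (cong (λ y → δ y x) (ℓ≗ℓ' zero)) (count-cong (λ i → ℓ≗ℓ' (suc i)) x)

  count-++ : ∀ p {q R} (ℓ : Fin (p ℕ.+ q) → Fin R) x →
             count ℓ x ≡ count {p} (λ i → ℓ (i ↑ˡ q)) x ℕ.+ count {q} (λ j → ℓ (p ↑ʳ j)) x
  count-++ zero ℓ x = refl
  count-++ (suc p) {q} ℓ x = trans (cong (δ (ℓ zero) x ℕ.+_) (count-++ p (λ r → ℓ (suc r)) x))
                                   (sym (ℕP.+-assoc (δ (ℓ zero) x) _ _))

  remQuot-↑ʳ : ∀ {K} p (j : Fin (K ℕ.* p)) → proj₂ (remQuot {suc K} p (p ↑ʳ j)) ≡ proj₂ (remQuot {K} p j)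
  remQuot-↑ʳ {K} p j = begin
      proj₂ (remQuot {suc K} p (p ↑ʳ j))
    ≡⟨ cong (λ r → proj₂ (remQuot {suc K} p (p ↑ʳ r))) (sym (FinP.combine-remQuot {K} p j)) ⟩
      proj₂ (remQuot {suc K} p (combine (suc (proj₁ (remQuot {K} p j))) (proj₂ (remQuot {K} p j))))
    ≡⟨ cong proj₂ (FinP.remQuot-combine {suc K} {p} (suc (proj₁ (remQuot {K} p j))) _) ⟩
      proj₂ (remQuot {K} p j) ∎
    where open ≡-Reasoning

  count-stacked : ∀ K p {R} (g : Fin p → Fin R) x →
                  count {K ℕ.* p} (λ r → g (proj₂ (remQuot {K} p r))) x ≡ K ℕ.* count g x
  count-stacked zero p g x = refl
  count-stacked (suc K) p g x = trans (count-++ p _ x) (cong₂ ℕ._+_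
    (count-cong (λ i → cong (λ rq → g (proj₂ rq)) (FinP.remQuot-combine {suc K} {p} zero i)) x)
    (trans (count-cong (λ j → cong g (remQuot-↑ʳ {K} p j)) x) (count-stacked K p g x)))

  count-suc-zero : ∀ {N R} (f : Fin N → Fin R) → count (λ i → suc (f i)) zero ≡ 0
  count-suc-zero {zero} f = refl
  count-suc-zero {suc N} f = count-suc-zero (λ i → f (suc i))

  count-suc-suc : ∀ {N R} (f : Fin N → Fin R) x → count (λ i → suc (f i)) (suc x) ≡ count f x
  count-suc-suc {zero} f x = refl
  count-suc-suc {suc N} f x = cong₂ ℕ._+_ (δ-suc (f zero) x) (count-suc-suc (λ i → f (suc i)) x)

  count-id : ∀ {n} (x : Fin n) → count id x ≡ 1
  count-id {suc n} zero = cong suc (count-suc-zero {n} id)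
  count-id {suc n} (suc x) = trans (count-suc-suc id x) (count-id x)

  count-punchIn-id : ∀ {p} (z : Fin (suc p)) x → count {p} (punchIn z) x ≡ 1 ∸ δ z x
  count-punchIn-id z x = trans (count-punchIn id z x) (cong (_∸ δ z x) (count-id x))

  Perm-kDSI : ∀ K p (G : Digraph (suc p) (K ℕ.* p)) z →
    Perm (kDSI K G z) ≡ mperm (λ x → K ℕ.* (1 ∸ δ z x)) (replicate (K ℕ.* p) true) (incidence G)
  Perm-kDSI K p G z = begin
      Perm (kDSI K G z)
    ≡⟨ Perm≡injPerm (kDSI K G z) ⟩
      injPerm (λ r → incidence G (row r)) (replicate (K ℕ.* p) true)
    ≡⟨ injPerm≡mperm (replicate (K ℕ.* p) true) row (incidence G) ⟩
      mperm (count row) (replicate (K ℕ.* p) true) (incidence G)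
    ≡⟨ mperm-cong (replicate (K ℕ.* p) true) (incidence G) (λ x → trans (count-stacked K p (punchIn z) x)
                                               (cong (K ℕ.*_) (count-punchIn-id z x))) ⟩
      mperm (λ x → K ℕ.* (1 ∸ δ z x)) (replicate (K ℕ.* p) true) (incidence G) ∎
    where
    open ≡-Reasoning
    row : Fin (K ℕ.* p) → Fin (suc p)
    row r = punchIn z (proj₂ (remQuot {K} p r))

  -- each column of the incidence matrix of a loopless graph has one +1 (the
  -- tail) and one -1 (the head), so its sum is zero
  incidence-zeroColumnSums : ∀ {n m} (G : Digraph n m) → Loopless G → ZeroColumnSums (incidence G)
  incidence-zeroColumnSums G loopless e = begin
      sum (λ v → incidence G v e)
    ≡⟨ sum-cong-≗ entry ⟩
      sum (λ v → + δ v (tail G e) * + 1 + + δ v (head G e) * - + 1)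
    ≡⟨ ∑-distrib-+ (λ v → + δ v (tail G e) * + 1) (λ v → + δ v (head G e) * - + 1) ⟩
      sum (λ v → + δ v (tail G e) * + 1) + sum (λ v → + δ v (head G e) * - + 1)
    ≡⟨ cong₂ _+_ (sum-δ (tail G e) (λ _ → + 1)) (sum-δ (head G e) (λ _ → - + 1)) ⟩
      + 0 ∎
    where
    open ≡-Reasoning
    entry : ∀ v → incidence G v e ≡ + δ v (tail G e) * + 1 + + δ v (head G e) * - + 1
    entry v with v ≟ tail G e
    ... | yes v≡tail rewrite δ-≢ {a = v} {b = head G e} (λ v≡head → loopless e (trans (sym v≡tail) v≡head))
                         = refl
    ... | no _ with v ≟ head G e
    ...   | yes _ = refl
    ...   | no _ = refl

  ∣-two-terms : ∀ {n} {d : ℤ} (f : Fin n → ℤ) {u w} → ¬ u ≡ w → d ∣ₛ sum f →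
                (∀ v → ¬ v ≡ u → ¬ v ≡ w → d ∣ₛ f v) → d ∣ₛ f u + f w
  ∣-two-terms {d = d} f {u} {w} u≢w d∣sum d∣others =
    ∣m+n∣n⇒∣m (subst (d ∣ₛ_) split d∣sum) (∣-sum remainder (λ v → d∣remainder v (v ≟ u) (v ≟ w)))
    where
    remainder : _ → ℤ
    remainder v = f v - (+ δ v u * f u + + δ v w * f w)
    remainder-at : ∀ v {a b} → δ v u ≡ a → δ v w ≡ b → remainder v ≡ f v - (+ a * f u + + b * f w)
    remainder-at v δu δw = cong₂ (λ a b → f v - (+ a * f u + + b * f w)) δu δw
    vanishes : ∀ {x} → x ≡ + 0 → d ∣ₛ x
    vanishes x≡0 = subst (d ∣ₛ_) (sym x≡0) (∣-zero d)
    -- the case split is on decisions passed as arguments, so that it does not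
    -- touch the deltas inside remainder v
    d∣remainder : ∀ v → Dec (v ≡ u) → Dec (v ≡ w) → d ∣ₛ remainder v
    d∣remainder v (yes refl) _ =
      vanishes (trans (remainder-at v (δ-refl v) (δ-≢ u≢w)) (atU (f v) (f w)))
      where
      atU : ∀ x y → x - (+ 1 * x + + 0 * y) ≡ + 0
      atU = solve-∀
    d∣remainder v (no v≢u) (yes refl) =
      vanishes (trans (remainder-at v (δ-≢ v≢u) (δ-refl v)) (atW (f u) (f v)))
      where
      atW : ∀ x y → y - (+ 0 * x + + 1 * y) ≡ + 0
      atW = solve-∀
    d∣remainder v (no v≢u) (no v≢w) =
      subst (d ∣ₛ_) (sym (trans (remainder-at v (δ-≢ v≢u) (δ-≢ v≢w)) (elsewhere (f v) (f u) (f w))))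
            (d∣others v v≢u v≢w)
      where
      elsewhere : ∀ t x y → t - (+ 0 * x + + 0 * y) ≡ t
      elsewhere = solve-∀
    split : sum f ≡ f u + f w + sum remainder
    split = begin
        sum f
      ≡⟨ sum-cong-≗ (λ v → sym (restore (f v) (+ δ v u * f u + + δ v w * f w))) ⟩
        sum (λ v → (+ δ v u * f u + + δ v w * f w) + remainder v)
      ≡⟨ ∑-distrib-+ (λ v → + δ v u * f u + + δ v w * f w) remainder ⟩
        sum (λ v → + δ v u * f u + + δ v w * f w) + sum remainder
      ≡⟨ cong (_+ sum remainder) (trans (∑-distrib-+ (λ v → + δ v u * f u) (λ v → + δ v w * f w))
                                        (cong₂ _+_ (sum-δ u (λ _ → f u)) (sum-δ w (λ _ → f w)))) ⟩
        f u + f w + sum remainder ∎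
      where
      open ≡-Reasoning
      restore : ∀ t y → y + (t - y) ≡ t
      restore = solve-∀

  suc-∣-factorial : ∀ K → + suc K ∣ₛ + (suc K !)
  suc-∣-factorial K = ∣ᵤ⇒∣ (ℕ∣.m∣m*n (K !))

  -- For odd K = 2m + 1, K + 1 = 2 (m + 1) divides 2 · K!, as m + 1 ≤ K.
  suc-odd-∣-twice-factorial : ∀ m → + suc (suc (2 ℕ.* m)) ∣ₛ + 2 * + (suc (2 ℕ.* m) !)
  suc-odd-∣-twice-factorial m = subst₂ (λ a b → + a ∣ₛ b) (ℕP.*-suc 2 m) (ℤP.pos-* 2 (suc (2 ℕ.* m) !))
    (∣ᵤ⇒∣ (ℕ∣.*-monoʳ-∣ 2 (ℕ∣.∣-trans (ℕ∣.m∣m*n (m !)) (ℕ∣.m≤n⇒m!∣n! (ℕ.s≤s (ℕP.m≤n*m m 2))))))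

  data Parity : ℕ → Set where
    even : ∀ m → Parity (2 ℕ.* m)
    odd : ∀ m → Parity (suc (2 ℕ.* m))

  parity : ∀ n → Parity n
  parity zero = even 0
  parity (suc n) with parity n
  ... | even m = odd m
  ... | odd m = subst Parity (ℕP.*-suc 2 m) (even (suc m))

  -1^even : ∀ m → -1ℤ ^ (2 ℕ.* m) ≡ + 1
  -1^even m = trans (sym (ℤP.^-*-assoc -1ℤ 2 m)) (ℤP.^-zeroˡ m)

  module TwoVertexChain {R M} {u w : Fin R} (u≢w : ¬ u ≡ w) (K : ℕ)
                        (S : Vec Bool M) (B : Fin R → Fin M → ℤ) (colSums : ZeroColumnSums B) where

    profile : ℕ → ℕ → Multiplicity R
    profile a b x = if ⌊ x ≟ u ⌋ then a else if ⌊ x ≟ w ⌋ then b else K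

    profile-u : ∀ a b → profile a b u ≡ a
    profile-u a b with u ≟ u
    ... | yes _ = refl
    ... | no u≢u = ⊥-elim (u≢u refl)

    profile-w : ∀ a b → profile a b w ≡ b
    profile-w a b with w ≟ u
    ... | yes w≡u = ⊥-elim (u≢w (sym w≡u))
    ... | no _ with w ≟ w
    ...   | yes _ = refl
    ...   | no w≢w = ⊥-elim (w≢w refl)

    profile-other : ∀ a b x → ¬ x ≡ u → ¬ x ≡ w → profile a b x ≡ K
    profile-other a b x x≢u x≢w with x ≟ u
    ... | yes x≡u = ⊥-elim (x≢u x≡u)
    ... | no _ with x ≟ w
    ...   | yes x≡w = ⊥-elim (x≢w x≡w)
    ...   | no _ = refl

    profile-ext : ∀ (c : Multiplicity R) a b → c u ≡ a → c w ≡ b →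
                  (∀ x → ¬ x ≡ u → ¬ x ≡ w → c x ≡ K) → ∀ x → c x ≡ profile a b x
    profile-ext c a b cu≡a cw≡b others x with x ≟ u
    ... | yes refl = cu≡a
    ... | no x≢u with x ≟ w
    ...   | yes refl = cw≡b
    ...   | no x≢w = others x x≢u x≢w

    D : ℕ → ℤ
    D a = mperm (profile a (K ∸ a)) S B

    -- Fact (2) for a copies of u and K - 1 - a copies of w: the terms adding
    -- row u or w give D (a + 1) and D a, every other term has K + 1 copies of
    -- some row and is divisible by (K + 1)! by fact (1).
    consecutive : ∀ a → a ℕ.< K → + suc K ∣ₛ D (suc a) + D a
    consecutive a a<K = subst₂ (λ x y → + suc K ∣ₛ x + y) (mperm-cong S B addU) (mperm-cong S B addW)
      (∣-two-terms (λ v → mperm (addRow c v) S B) u≢w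
        (subst (+ suc K ∣ₛ_) (sym (mperm-addRow-sum S B colSums c)) (∣-zero _)) others)
      where
      c = profile a (K ∸ suc a)
      addU : ∀ x → addRow c u x ≡ profile (suc a) (K ∸ suc a) x
      addU = profile-ext (addRow c u) _ _
        (cong₂ ℕ._+_ (δ-refl u) (profile-u a _))
        (cong₂ ℕ._+_ (δ-≢ u≢w) (profile-w a _))
        (λ x x≢u x≢w → cong₂ ℕ._+_ (δ-≢ (≢-sym x≢u)) (profile-other a _ x x≢u x≢w))
      addW : ∀ x → addRow c w x ≡ profile a (K ∸ a) x
      addW = profile-ext (addRow c w) _ _
        (cong₂ ℕ._+_ (δ-≢ (≢-sym u≢w)) (profile-u a _))
        (trans (cong₂ ℕ._+_ (δ-refl w) (profile-w a _)) (sym (ℕP.+-∸-assoc 1 a<K)))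
        (λ x x≢u x≢w → cong₂ ℕ._+_ (δ-≢ (≢-sym x≢w)) (profile-other a _ x x≢u x≢w))
      others : ∀ v → ¬ v ≡ u → ¬ v ≡ w → + suc K ∣ₛ mperm (addRow c v) S B
      others v v≢u v≢w = ∣-trans (suc-∣-factorial K)
        (subst (λ m → + (m !) ∣ₛ mperm (addRow c v) S B)
               (cong₂ ℕ._+_ (δ-refl v) (profile-other a _ v v≢u v≢w))
               (factorial-∣-mperm S B (addRow c v) v))

    alternating : ∀ a → a ℕ.≤ K → + suc K ∣ₛ D a - -1ℤ ^ a * D 0
    alternating zero _ = subst (+ suc K ∣ₛ_) (sym (cancel (D 0))) (∣-zero _)
      where
      cancel : ∀ x → x - + 1 * x ≡ + 0
      cancel = solve-∀
    alternating (suc a) a<K = subst (+ suc K ∣ₛ_) (telescope (D (suc a)) (D a) (-1ℤ ^ a) (D 0))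
        (∣m∣n⇒∣m-n (consecutive a a<K) (alternating a (ℕP.<⇒≤ a<K)))
      where
      telescope : ∀ x y s z → x + y - (y - s * z) ≡ x - -1ℤ * s * z
      telescope = solve-∀

    ends : + suc K ∣ₛ D 0 - D K
    ends with parity K | alternating K ℕP.≤-refl
    ... | even m | K+1∣DK-D0 = subst (+ suc (2 ℕ.* m) ∣ₛ_) (flip (D K) (D 0))
          (∣m⇒∣-m (subst (λ s → + suc (2 ℕ.* m) ∣ₛ D K - s * D 0) (-1^even m) K+1∣DK-D0))
      where
      flip : ∀ x y → - (x - + 1 * y) ≡ y - x
      flip = solve-∀
    ... | odd m | K+1∣DK+D0 = subst (+ suc K ∣ₛ_) (oddEnds (D K) (D 0) (-1ℤ ^ (2 ℕ.* m)) (-1^even m))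
          (∣m∣n⇒∣m-n twiceD0 K+1∣DK+D0)
      where
      oddEnds : ∀ x y s → s ≡ + 1 → + 2 * y - (x - -1ℤ * s * y) ≡ y - x
      oddEnds x y s refl = twice x y
        where
        twice : ∀ x y → + 2 * y - (x - -1ℤ * + 1 * y) ≡ y - x
        twice = solve-∀
      -- K! divides D 0, which has K copies of w
      twiceD0 : + suc K ∣ₛ + 2 * D 0
      twiceD0 = ∣-trans (suc-odd-∣-twice-factorial m) (*-monoʳ-∣ (+ 2)
        (subst (λ b → + (b !) ∣ₛ D 0) (profile-w 0 K) (factorial-∣-mperm S B (profile 0 K) w)))

    without-u : ∀ x → K ℕ.* (1 ∸ δ u x) ≡ profile 0 (K ∸ 0) x
    without-u = profile-ext _ 0 K
      (trans (cong (λ d → K ℕ.* (1 ∸ d)) (δ-refl u)) (ℕP.*-zeroʳ K))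
      (trans (cong (λ d → K ℕ.* (1 ∸ d)) (δ-≢ u≢w)) (ℕP.*-identityʳ K))
      (λ x x≢u _ → trans (cong (λ d → K ℕ.* (1 ∸ d)) (δ-≢ (≢-sym x≢u))) (ℕP.*-identityʳ K))

    without-w : ∀ x → K ℕ.* (1 ∸ δ w x) ≡ profile K (K ∸ K) x
    without-w = profile-ext _ K (K ∸ K)
      (trans (cong (λ d → K ℕ.* (1 ∸ d)) (δ-≢ (≢-sym u≢w))) (ℕP.*-identityʳ K))
      (trans (cong (λ d → K ℕ.* (1 ∸ d)) (δ-refl w)) (trans (ℕP.*-zeroʳ K) (sym (ℕP.n∸n≡0 K))))
      (λ x _ x≢w → trans (cong (λ d → K ℕ.* (1 ∸ d)) (δ-≢ (≢-sym x≢w))) (ℕP.*-identityʳ K))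

open import Defs
open import Data.Nat using (ℕ; suc; _*_)
open import Data.Fin using (Fin; _≟_)
open import Data.Integer using (+_; _-_)
open import Data.Integer.Divisibility using (_∣_)

open import Data.Bool using (true)
open import Data.Integer.Divisibility.Signed using (∣⇒∣ᵤ) renaming (_∣_ to _∣ₛ_)
open import Data.Integer.Properties using (+-inverseʳ)
open import Data.Nat.Divisibility using (_∣0)
open import Data.Vec using (replicate)
open import Relation.Binary.PropositionalEquality using (_≡_; refl; sym; trans; subst; subst₂)
open import Relation.Nullary using (yes; no)
open Permanents using (mperm-cong; Perm-kDSI; incidence-zeroColumnSums; module TwoVertexChain)

theorem2p9 : (k p : ℕ) → (G : Digraph (suc p) (suc k * p)) →
    Loopless G → Connected G → (u w : Fin (suc p)) →
    (+ suc (suc k)) ∣ (Perm (kDSI (suc k) G u) - Perm (kDSI (suc k) G w))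
theorem2p9 k p G loopless _ u w with u ≟ w
... | yes refl = subst (+ suc (suc k) ∣_) (sym (+-inverseʳ (Perm (kDSI (suc k) G u)))) (suc (suc k) ∣0)
... | no u≢w = ∣⇒∣ᵤ (subst₂ (λ x y → + suc K ∣ₛ x - y) (sym Perm-u) (sym Perm-w) ends)
  where
  K = suc k
  columns = replicate (K * p) true
  open TwoVertexChain u≢w K columns (incidence G) (incidence-zeroColumnSums G loopless)
  Perm-u : Perm (kDSI K G u) ≡ D 0
  Perm-u = trans (Perm-kDSI K p G u) (mperm-cong columns (incidence G) without-u)
  Perm-w : Perm (kDSI K G w) ≡ D K
  Perm-w = trans (Perm-kDSI K p G w) (mperm-cong columns (incidence G) without-w)
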